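{- Let $n\ge 3$ be odd and let $D$ be the directed graph on $[n+1]$ with arc set $\{1v: v\ne 1\}\cup\{vv: v\ne 1\}$. Then $\mathrm{crank}[D]=2^n$, $\mathrm{minrank}[D,2]=2^{\lceil n/2\rceil}+2^{\lfloor n/2\rfloor}-1$, and $\mathrm{minrank}[D,n]=\mathrm{minrank}[D]=n+1$.
   Context: For $q\ge2$, $\langle q\rangle=\{0,\dots,q-1\}$. For $f:\langle q\rangle^{N}\to\langle q\rangle^{N}$ (here $N=n+1$), $\mathrm{IG}(f)$ is the graph on $[N]$ with an arc $uv$ iff there exist $a,b$ differing only in coordinate $u$ with $f_v(a)\ne f_v(b)$; $F[D,q]=\{f:\mathrm{IG}(f)=D\}$; $\operatorname{rank}(f)$ is the number of images of $f$; $\mathrm{minrank}[D,q]=\min_{f\in F[D,q]}\operatorname{rank}(f)$, $\mathrm{minrank}[D]=\min_{q\ge 2}\mathrm{minrank}[D,q]$. The conjunctive network on $D$ is the Boolean map with $f_v(x)=\bigwedge_{u\in N^-(v)}x_u$ (empty conjunction equal to $1$), and $\mathrm{crank}[D]$ is its rank. -}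

module Defs where

open import Data.Nat using (ℕ; zero; suc; _≤_)
open import Data.Fin using (Fin; zero; suc; _≟_)
open import Data.Bool using (Bool; true; false; T; _∨_; _∧_; not; if_then_else_)
open import Data.Vec using (Vec; []; _∷_; lookup; tabulate; _[_]≔_)
open import Data.Vec.Properties using (≡-dec)
open import Data.List using (List; []; _∷_; map; concatMap; length; filter; allFin)
open import Data.List.Relation.Unary.Any using (any?)
open import Data.Product using (Σ; ∃; _×_; _,_)
open import Relation.Binary.PropositionalEquality using (_≡_; _≢_)
open import Relation.Nullary using (Dec; does)
open import Function.Bundles using (_⇔_)

Config : ℕ → ℕ → Set
Config q N = Vec (Fin q) N

Network : ℕ → ℕ → Set
Network q N = Config q N → Config q N

allConfigs : (q N : ℕ) → List (Config q N)
allConfigs q zero = [] ∷ []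
allConfigs q (suc N) = concatMap (λ a → map (a ∷_) (allConfigs q N)) (allFin q)

rank : {q N : ℕ} → Network q N → ℕ
rank {q} {N} f =
  length (filter (λ y → any? (λ x → ≡-dec _≟_ (f x) y) (allConfigs q N)) (allConfigs q N))

Digraph : ℕ → Set
Digraph N = Fin N → Fin N → Bool

IGArc : {q N : ℕ} → Network q N → Fin N → Fin N → Set
IGArc {q} f u v = Σ (Config q _) λ a → Σ (Fin q) λ c →
  lookup (f a) v ≢ lookup (f (a [ u ]≔ c)) v

InF : {N : ℕ} → Digraph N → (q : ℕ) → Network q N → Set
InF D q f = ∀ u v → IGArc f u v ⇔ T (D u v)

MinrankIs : {N : ℕ} → Digraph N → (q : ℕ) → ℕ → Set
MinrankIs D q m =
  (Σ (Network q _) λ f → InF D q f × rank f ≡ m) ×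
  (∀ (f : Network q _) → InF D q f → m ≤ rank f)

MinrankAllIs : {N : ℕ} → Digraph N → ℕ → Set
MinrankAllIs D m =
  (Σ ℕ λ q → 2 ≤ q × Σ (Network q _) λ f → InF D q f × rank f ≡ m) ×
  (∀ (q : ℕ) → 2 ≤ q → ∀ (f : Network q _) → InF D q f → m ≤ rank f)

isOne : Fin 2 → Bool
isOne zero = false
isOne (suc _) = true

fromBool : Bool → Fin 2
fromBool false = zero
fromBool true = suc zero

allB : {A : Set} → (A → Bool) → List A → Bool
allB p [] = true
allB p (x ∷ xs) = p x ∧ allB p xs

-- conjunctive network on D: f_v(x) = ⋀_{u ∈ N⁻(v)} x_u  (empty conjunction = 1)
conjNet : {N : ℕ} → Digraph N → Network 2 N
conjNet {N} D x = tabulate λ v → fromBool (allB (λ u → not (D u v) ∨ isOne (lookup x u)) (allFin N))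

crank : {N : ℕ} → Digraph N → ℕ
crank D = rank (conjNet D)

-- the digraph of Theorem 3.10 on [n+1]; vertex 1 of the paper is Fin.zero:
-- arcs 1v for v ≠ 1, and loops vv for v ≠ 1
isZero : {N : ℕ} → Fin N → Bool
isZero zero = true
isZero (suc _) = false

eqFin : {N : ℕ} → Fin N → Fin N → Bool
eqFin u v = does (u ≟ v)

Dthm : (n : ℕ) → Digraph (suc n)
Dthm n u v = not (isZero v) ∧ (isZero u ∨ eqFin u v)

-- Every f ∈ F[D,q] has a constant coordinate 0, and its coordinate v+1 reads only x₀ and x_{v+1}:
-- f(a, x) = (c, g(a,1,x₁), …, g(a,n,x_n)). So the image of f is c followed by the union over a of
-- the boxes ∏_v Im g(a,v,·), and the loop at v makes some column g(a,v,·) nonconstant. Hence the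
-- image contains an edge in every coordinate direction, which forces n+1 points; letting x₀ pick the
-- single coordinate that may be nonzero attains this. For q = 2 there are two boxes and every column
-- is full in one of them; shrinking the second box to meet the first in one point gives
-- rank f ≥ 2^a + 2^b − 1 with a + b = n, minimal for the balanced split, and two complementary boxes
-- attain it. The conjunctive network always sets coordinate 0 to 1 and fixes every x with x₀ = 1.

module Submission where

open import Defs
open import Data.Bool using (Bool; true; false; T; _∨_; _∧_; not; if_then_else_)
open import Data.Bool.Properties using (∧-zeroʳ; T-≡; T-∨; T-∧)
open import Data.Empty using (⊥-elim)
open import Data.Fin using (Fin; zero; suc; _≟_; toℕ)
open import Data.Fin.Properties using () renaming (0≢1+n to 0≢suc)
open import Data.List using (List; []; _∷_; _++_; map; concatMap; length; allFin; filter)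
import Data.List as List
open import Data.List.Properties using (length-map; length-tabulate)
open import Data.List.Membership.Propositional using (_∈_; lose)
open import Data.List.Membership.Propositional.Properties using (∈-allFin; ∈-map⁺; ∈-concatMap⁺)
open import Data.List.Relation.Unary.Any using (here; there; any?; satisfied)
open import Data.Nat using (ℕ; zero; suc; _+_; _*_; _∸_; _^_; _≤_; _<_; z≤n; s≤s; _<ᵇ_; _≤?_; _%_; ⌈_/2⌉; ⌊_/2⌋)
open import Data.Nat.Properties hiding (_≟_)
open import Data.Nat.Solver using (module +-*-Solver)
open import Data.Product using (∃; ∃₂; _×_; _,_; proj₁; proj₂)
open import Data.Sum using (inj₁; inj₂)
open import Data.Unit using (tt)
open import Data.Vec using (Vec; []; _∷_; lookup; tabulate; replicate; head; tail; _[_]≔_)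
open import Data.Vec.Properties using (≡-dec; lookup∘tabulate; lookup∘update; lookup∘update′; []≔-lookup; lookup-replicate)
open import Data.Vec.Relation.Binary.Pointwise.Extensional using (ext; Pointwise-≡⇒≡)
open import Function using (_∘_)
open import Function.Bundles using (mk⇔; Equivalence)
open import Relation.Binary.PropositionalEquality
open import Relation.Nullary using (Dec; yes; no; does)
open import Relation.Nullary.Decidable using (decidable-stable)

-- Sums and counting

∑ : {A : Set} → List A → (A → ℕ) → ℕ
∑ []       g = 0
∑ (x ∷ xs) g = g x + ∑ xs g

module _ {A : Set} where

  ∑-cong : (xs : List A) {g h : A → ℕ} → (∀ x → g x ≡ h x) → ∑ xs g ≡ ∑ xs h
  ∑-cong []       g≡h = refl
  ∑-cong (x ∷ xs) g≡h = cong₂ _+_ (g≡h x) (∑-cong xs g≡h)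

  ∑-mono-≤ : (xs : List A) {g h : A → ℕ} → (∀ x → g x ≤ h x) → ∑ xs g ≤ ∑ xs h
  ∑-mono-≤ []       g≤h = z≤n
  ∑-mono-≤ (x ∷ xs) g≤h = +-mono-≤ (g≤h x) (∑-mono-≤ xs g≤h)

  ∑-mono-< : (xs : List A) {g h : A → ℕ} → (∀ x → g x ≤ h x) →
             ∀ {x} → x ∈ xs → g x < h x → ∑ xs g < ∑ xs h
  ∑-mono-< (x ∷ xs) g≤h (here refl) gx<hx = +-mono-<-≤ gx<hx (∑-mono-≤ xs g≤h)
  ∑-mono-< (x ∷ xs) g≤h (there x∈) gx<hx = +-mono-≤-< (g≤h x) (∑-mono-< xs g≤h x∈ gx<hx)

  term≤∑ : (xs : List A) (g : A → ℕ) → ∀ {x} → x ∈ xs → g x ≤ ∑ xs g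
  term≤∑ (x ∷ xs) g (here refl) = m≤m+n (g x) _
  term≤∑ (x ∷ xs) g (there x∈) = ≤-trans (term≤∑ xs g x∈) (m≤n+m _ (g x))

  ∑-++ : (xs ys : List A) (g : A → ℕ) → ∑ (xs ++ ys) g ≡ ∑ xs g + ∑ ys g
  ∑-++ []       ys g = refl
  ∑-++ (x ∷ xs) ys g = trans (cong (g x +_) (∑-++ xs ys g)) (sym (+-assoc (g x) _ _))

  ∑-+ : (xs : List A) (g h : A → ℕ) → ∑ xs (λ x → g x + h x) ≡ ∑ xs g + ∑ xs h
  ∑-+ []       g h = refl
  ∑-+ (x ∷ xs) g h = trans (cong (g x + h x +_) (∑-+ xs g h))
                           (solve 4 (λ a b c d → (a :+ b) :+ (c :+ d) := (a :+ c) :+ (b :+ d)) refl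
                                  (g x) (h x) (∑ xs g) (∑ xs h))
    where open +-*-Solver

  ∑-*ˡ : (xs : List A) (c : ℕ) (g : A → ℕ) → ∑ xs (λ x → c * g x) ≡ c * ∑ xs g
  ∑-*ˡ []       c g = sym (*-zeroʳ c)
  ∑-*ˡ (x ∷ xs) c g = trans (cong (c * g x +_) (∑-*ˡ xs c g)) (sym (*-distribˡ-+ c (g x) _))

  ∑-const-0 : (xs : List A) → ∑ xs (λ _ → 0) ≡ 0
  ∑-const-0 []       = refl
  ∑-const-0 (x ∷ xs) = ∑-const-0 xs

  ∑-const-1 : (xs : List A) → ∑ xs (λ _ → 1) ≡ length xs
  ∑-const-1 []       = refl
  ∑-const-1 (x ∷ xs) = cong suc (∑-const-1 xs)

∑-map : {A B : Set} (h : A → B) (xs : List A) (g : B → ℕ) → ∑ (map h xs) g ≡ ∑ xs (g ∘ h)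
∑-map h []       g = refl
∑-map h (x ∷ xs) g = cong (g (h x) +_) (∑-map h xs g)

∑-concatMap : {A B : Set} (F : A → List B) (xs : List A) (g : B → ℕ) →
              ∑ (concatMap F xs) g ≡ ∑ xs (λ x → ∑ (F x) g)
∑-concatMap F []       g = refl
∑-concatMap F (x ∷ xs) g = trans (∑-++ (F x) (concatMap F xs) g) (cong (∑ (F x) g +_) (∑-concatMap F xs g))

∑-swap : {A B : Set} (xs : List A) (ys : List B) (h : A → B → ℕ) →
         ∑ xs (λ x → ∑ ys (h x)) ≡ ∑ ys (λ y → ∑ xs (λ x → h x y))
∑-swap []       ys h = sym (∑-const-0 ys)
∑-swap (x ∷ xs) ys h = trans (cong (∑ ys (h x) +_) (∑-swap xs ys h)) (sym (∑-+ ys (h x) _))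

∑-tabulate : {q : ℕ} {A : Set} (f : Fin q → A) (g : A → ℕ) → ∑ (List.tabulate f) g ≡ ∑ (allFin q) (g ∘ f)
∑-tabulate {zero}  f g = refl
∑-tabulate {suc q} f g = cong (g (f zero) +_) (trans (∑-tabulate (f ∘ suc) g) (sym (∑-tabulate suc (g ∘ f))))

does⇒ : {A : Set} (d : Dec A) → T (does d) → A
does⇒ (yes a) _ = a

⇒does : {A : Set} (d : Dec A) → A → T (does d)
⇒does (yes _) _ = tt
⇒does (no ¬a) a = ⊥-elim (¬a a)

eqFin⇒≡ : {N : ℕ} {u v : Fin N} → T (eqFin u v) → u ≡ v
eqFin⇒≡ {u = u} {v} = does⇒ (u ≟ v)

eqFin-refl : {N : ℕ} (u : Fin N) → T (eqFin u u)
eqFin-refl u = ⇒does (u ≟ u) refl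

eqFin-≢ : {N : ℕ} {u v : Fin N} → u ≢ v → eqFin u v ≡ false
eqFin-≢ {u = u} {v} u≢v with u ≟ v
... | yes u≡v = ⊥-elim (u≢v u≡v)
... | no  _   = refl

one : Fin 2
one = suc zero

ind : Bool → ℕ
ind true  = 1
ind false = 0

T⇒ind≡1 : {b : Bool} → T b → ind b ≡ 1
T⇒ind≡1 {true} _ = refl

ind-mono : {a b : Bool} → (T a → T b) → ind a ≤ ind b
ind-mono {false}         _   = z≤n
ind-mono {true}  {true}  _   = ≤-refl
ind-mono {true}  {false} a⇒b = ⊥-elim (a⇒b tt)

ind-∨+∧ : (a b : Bool) → ind (a ∨ b) + ind (a ∧ b) ≡ ind a + ind b
ind-∨+∧ true  true  = refl
ind-∨+∧ true  false = refl
ind-∨+∧ false b     = +-identityʳ (ind b)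

ind-∧ : (a b : Bool) → ind (a ∧ b) ≡ ind a * ind b
ind-∧ true  b = sym (+-identityʳ (ind b))
ind-∧ false b = refl

ind+ind-not : (b : Bool) → ind b + ind (not b) ≡ 1
ind+ind-not true  = refl
ind+ind-not false = refl

card : {q : ℕ} → (Fin q → Bool) → ℕ
card {q} s = ∑ (allFin q) (ind ∘ s)

card-suc : {q : ℕ} (s : Fin (suc q) → Bool) → card s ≡ ind (s zero) + card (s ∘ suc)
card-suc {q} s = cong (ind (s zero) +_) (∑-tabulate suc (ind ∘ s))

card-≡ : {q : ℕ} (b : Fin q) → card (λ a → eqFin a b) ≡ 1
card-≡ {suc q} zero    = trans (card-suc {q} (λ a → eqFin a zero)) (cong suc (∑-const-0 (allFin q)))
card-≡ {suc q} (suc b) = trans (card-suc (λ a → eqFin a (suc b))) (card-≡ b)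

card+card-not : {n : ℕ} (t : Fin n → Bool) → card t + card (not ∘ t) ≡ n
card+card-not {n} t = begin
  card t + card (not ∘ t)              ≡⟨ ∑-+ (allFin n) (ind ∘ t) (ind ∘ not ∘ t) ⟨
  ∑ (allFin n) (λ v → ind (t v) + ind (not (t v))) ≡⟨ ∑-cong (allFin n) (ind+ind-not ∘ t) ⟩
  ∑ (allFin n) (λ _ → 1)               ≡⟨ ∑-const-1 (allFin n) ⟩
  length (allFin n)                    ≡⟨ length-tabulate (λ v → v) ⟩
  n                                    ∎
  where open ≡-Reasoning

1≤card : {q : ℕ} (s : Fin q → Bool) {a : Fin q} → T (s a) → 1 ≤ card s
1≤card {q} s {a} sa = subst (_≤ card s) (T⇒ind≡1 sa) (term≤∑ (allFin q) (ind ∘ s) (∈-allFin a))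

2≤card : {q : ℕ} (s : Fin q → Bool) {a b : Fin q} → a ≢ b → T (s a) → T (s b) → 2 ≤ card s
2≤card {suc q} s {zero}  {zero}  a≢b _  _  = ⊥-elim (a≢b refl)
2≤card {suc q} s {zero}  {suc b} _   sa sb rewrite card-suc s | T⇒ind≡1 sa = s≤s (1≤card (s ∘ suc) sb)
2≤card {suc q} s {suc a} {zero}  _   sa sb rewrite card-suc s | T⇒ind≡1 sb = s≤s (1≤card (s ∘ suc) sa)
2≤card {suc q} s {suc a} {suc b} a≢b sa sb rewrite card-suc s =
  ≤-trans (2≤card (s ∘ suc) (a≢b ∘ cong suc) sa sb) (m≤n+m _ (ind (s zero)))

∏ : {N : ℕ} → (Fin N → ℕ) → ℕ
∏ {zero}  g = 1
∏ {suc N} g = g zero * ∏ (g ∘ suc)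

∏-cong : {N : ℕ} {g h : Fin N → ℕ} → (∀ v → g v ≡ h v) → ∏ g ≡ ∏ h
∏-cong {zero}  g≡h = refl
∏-cong {suc N} g≡h = cong₂ _*_ (g≡h zero) (∏-cong (g≡h ∘ suc))

∏-const : (N c : ℕ) → ∏ {N} (λ _ → c) ≡ c ^ N
∏-const zero    c = refl
∏-const (suc N) c = cong (c *_) (∏-const N c)

∏-1 : (N : ℕ) → ∏ {N} (λ _ → 1) ≡ 1
∏-1 N = trans (∏-const N 1) (^-zeroˡ N)

∏-2^ind : {N : ℕ} (t : Fin N → Bool) → ∏ (λ v → 2 ^ ind (t v)) ≡ 2 ^ card t
∏-2^ind {zero}  t = refl
∏-2^ind {suc N} t = begin
  2 ^ ind (t zero) * ∏ (λ v → 2 ^ ind (t (suc v))) ≡⟨ cong (2 ^ ind (t zero) *_) (∏-2^ind (t ∘ suc)) ⟩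
  2 ^ ind (t zero) * 2 ^ card (t ∘ suc)             ≡⟨ ^-distribˡ-+-* 2 (ind (t zero)) (card (t ∘ suc)) ⟨
  2 ^ (ind (t zero) + card (t ∘ suc))               ≡⟨ cong (2 ^_) (card-suc t) ⟨
  2 ^ card t                                        ∎
  where open ≡-Reasoning

inBox : {q N : ℕ} → (Fin N → Fin q → Bool) → Config q N → Bool
inBox s []       = true
inBox s (y ∷ ys) = s zero y ∧ inBox (s ∘ suc) ys

inBox⇒ : {q N : ℕ} (s : Fin N → Fin q → Bool) (ys : Config q N) → T (inBox s ys) → ∀ v → T (s v (lookup ys v))
inBox⇒ s (y ∷ ys) h zero    = proj₁ (Equivalence.to T-∧ h)
inBox⇒ s (y ∷ ys) h (suc v) = inBox⇒ (s ∘ suc) ys (proj₂ (Equivalence.to T-∧ h)) v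

⇒inBox : {q N : ℕ} (s : Fin N → Fin q → Bool) (ys : Config q N) → (∀ v → T (s v (lookup ys v))) → T (inBox s ys)
⇒inBox s []       h = tt
⇒inBox s (y ∷ ys) h = Equivalence.from T-∧ (h zero , ⇒inBox (s ∘ suc) ys (h ∘ suc))

inBox-∧ : {q N : ℕ} (s r : Fin N → Fin q → Bool) (ys : Config q N) →
          (inBox s ys ∧ inBox r ys) ≡ inBox (λ v y → s v y ∧ r v y) ys
inBox-∧ s r []       = refl
inBox-∧ s r (y ∷ ys) = trans (∧-interchange (s zero y) (inBox (s ∘ suc) ys) (r zero y) (inBox (r ∘ suc) ys))
                             (cong ((s zero y ∧ r zero y) ∧_) (inBox-∧ (s ∘ suc) (r ∘ suc) ys))
  where
  ∧-interchange : (a b c d : Bool) → (a ∧ b) ∧ (c ∧ d) ≡ (a ∧ c) ∧ (b ∧ d)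
  ∧-interchange true  b true  d = refl
  ∧-interchange true  b false d = ∧-zeroʳ b
  ∧-interchange false b c     d = refl

count : {q N : ℕ} → (Config q N → Bool) → ℕ
count {q} {N} p = ∑ (allConfigs q N) (ind ∘ p)

module _ {q N : ℕ} where

  count-cong : {p r : Config q N → Bool} → (∀ y → p y ≡ r y) → count p ≡ count r
  count-cong p≡r = ∑-cong (allConfigs q N) (cong ind ∘ p≡r)

  count-mono : {p r : Config q N → Bool} → (∀ y → T (p y) → T (r y)) → count p ≤ count r
  count-mono p⇒r = ∑-mono-≤ (allConfigs q N) (ind-mono ∘ p⇒r)

  count-∨+∧ : (p r : Config q N → Bool) →
              count (λ y → p y ∨ r y) + count (λ y → p y ∧ r y) ≡ count p + count r
  count-∨+∧ p r = begin
    count (λ y → p y ∨ r y) + count (λ y → p y ∧ r y)           ≡⟨ ∑-+ (allConfigs q N) _ _ ⟨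
    ∑ (allConfigs q N) (λ y → ind (p y ∨ r y) + ind (p y ∧ r y)) ≡⟨ ∑-cong (allConfigs q N) (λ y → ind-∨+∧ (p y) (r y)) ⟩
    ∑ (allConfigs q N) (λ y → ind (p y) + ind (r y))             ≡⟨ ∑-+ (allConfigs q N) _ _ ⟩
    count p + count r                                             ∎
    where open ≡-Reasoning

count-cons : {q N : ℕ} (p : Config q (suc N) → Bool) → count p ≡ ∑ (allFin q) (λ a → count (λ ys → p (a ∷ ys)))
count-cons {q} {N} p = trans (∑-concatMap (λ a → map (a ∷_) (allConfigs q N)) (allFin q) (ind ∘ p))
                             (∑-cong (allFin q) (λ a → ∑-map (a ∷_) (allConfigs q N) (ind ∘ p)))

fiber≤count : {q N : ℕ} (p : Config q (suc N) → Bool) (a : Fin q) → count (λ ys → p (a ∷ ys)) ≤ count p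
fiber≤count {q} {N} p a = subst (count {q} {N} (λ ys → p (a ∷ ys)) ≤_) (sym (count-cons p))
  (term≤∑ (allFin q) (λ a → count {q} {N} (λ ys → p (a ∷ ys))) (∈-allFin a))

count-head∧tail : {q N : ℕ} (s : Fin q → Bool) (r : Config q N → Bool) →
                  count (λ y → s (head y) ∧ r (tail y)) ≡ card s * count r
count-head∧tail {q} {N} s r = begin
  count (λ y → s (head y) ∧ r (tail y))                       ≡⟨ count-cons (λ y → s (head y) ∧ r (tail y)) ⟩
  ∑ (allFin q) (λ a → count (λ ys → s a ∧ r ys))              ≡⟨ ∑-cong (allFin q) (λ a → ∑-cong (allConfigs q N) (λ ys → ind-∧ (s a) (r ys))) ⟩
  ∑ (allFin q) (λ a → ∑ (allConfigs q N) (λ ys → ind (s a) * ind (r ys))) ≡⟨ ∑-cong (allFin q) (λ a → ∑-*ˡ (allConfigs q N) (ind (s a)) (ind ∘ r)) ⟩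
  ∑ (allFin q) (λ a → ind (s a) * count r)                    ≡⟨ ∑-cong (allFin q) (λ a → *-comm (ind (s a)) (count r)) ⟩
  ∑ (allFin q) (λ a → count r * ind (s a))                    ≡⟨ ∑-*ˡ (allFin q) (count r) (ind ∘ s) ⟩
  count r * card s                                            ≡⟨ *-comm (count r) (card s) ⟩
  card s * count r                                            ∎
  where open ≡-Reasoning

count-inBox : {q N : ℕ} (s : Fin N → Fin q → Bool) → count (inBox s) ≡ ∏ (λ v → card (s v))
count-inBox {q} {zero}  s = refl
count-inBox {q} {suc N} s = begin
  count (inBox s)                                        ≡⟨ count-cong {q} {suc N} (λ { (y ∷ ys) → refl }) ⟩
  count (λ y → s zero (head y) ∧ inBox (s ∘ suc) (tail y)) ≡⟨ count-head∧tail (s zero) (inBox (s ∘ suc)) ⟩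
  card (s zero) * count (inBox (s ∘ suc))                ≡⟨ cong (card (s zero) *_) (count-inBox (s ∘ suc)) ⟩
  ∏ (λ v → card (s v))                                   ∎
  where open ≡-Reasoning

count-true : (N : ℕ) → count {2} {N} (λ _ → true) ≡ 2 ^ N
count-true N = begin
  count {2} {N} (λ _ → true)          ≡⟨ count-cong {2} {N} inBox-true ⟨
  count {2} {N} (inBox (λ _ _ → true)) ≡⟨ count-inBox {2} {N} (λ _ _ → true) ⟩
  ∏ {N} (λ _ → 2)                     ≡⟨ ∏-const N 2 ⟩
  2 ^ N                               ∎
  where
  open ≡-Reasoning
  inBox-true : {M : ℕ} (ys : Config 2 M) → inBox (λ _ _ → true) ys ≡ true
  inBox-true []       = refl
  inBox-true (y ∷ ys) = inBox-true ys

isPoint : {q N : ℕ} → Config q N → Config q N → Bool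
isPoint l = inBox (λ v a → eqFin a (lookup l v))

count-isPoint : {q N : ℕ} (l : Config q N) → count (isPoint l) ≡ 1
count-isPoint {q} {N} l = trans (count-inBox {q} {N} _) (trans (∏-cong (λ v → card-≡ (lookup l v))) (∏-1 N))

count≤length : {q N : ℕ} (p : Config q N → Bool) (L : List (Config q N)) →
               (∀ y → T (p y) → y ∈ L) → count p ≤ length L
count≤length {q} {N} p L p⊆L = begin
  count p                                                  ≤⟨ ∑-mono-≤ (allConfigs q N) covered ⟩
  ∑ (allConfigs q N) (λ y → ∑ L (λ l → ind (isPoint l y))) ≡⟨ ∑-swap (allConfigs q N) L (λ y l → ind (isPoint l y)) ⟩
  ∑ L (λ l → count (isPoint l))                            ≡⟨ ∑-cong L count-isPoint ⟩
  ∑ L (λ _ → 1)                                            ≡⟨ ∑-const-1 L ⟩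
  length L                                                 ∎
  where
  open ≤-Reasoning
  covered : ∀ y → ind (p y) ≤ ∑ L (λ l → ind (isPoint l y))
  covered y with p y in py
  ... | false = z≤n
  ... | true  = subst (_≤ ∑ L (λ l → ind (isPoint l y))) (T⇒ind≡1 (⇒inBox _ y (λ v → eqFin-refl (lookup y v))))
                      (term≤∑ L (λ l → ind (isPoint l y)) (p⊆L y (subst T (sym py) tt)))

allConfigs-complete : {q N : ℕ} (x : Config q N) → x ∈ allConfigs q N
allConfigs-complete []       = here refl
allConfigs-complete {q} {suc N} (a ∷ xs) = ∈-concatMap⁺ (λ b → map (b ∷_) (allConfigs q N)) (lose (∈-allFin a) (∈-map⁺ (a ∷_) (allConfigs-complete xs)))

isImage : {q N : ℕ} → Network q N → Config q N → Bool
isImage {q} {N} f y = does (any? (λ x → ≡-dec _≟_ (f x) y) (allConfigs q N))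

length-filter≡∑ : {A : Set} {P : A → Set} (P? : (x : A) → Dec (P x)) (xs : List A) →
                  length (filter P? xs) ≡ ∑ xs (ind ∘ does ∘ P?)
length-filter≡∑ P? []       = refl
length-filter≡∑ P? (x ∷ xs) with does (P? x)
... | true  = cong suc (length-filter≡∑ P? xs)
... | false = length-filter≡∑ P? xs

module _ {q N : ℕ} (f : Network q N) where

  rank≡count : rank f ≡ count (isImage f)
  rank≡count = length-filter≡∑ (λ y → any? (λ x → ≡-dec _≟_ (f x) y) (allConfigs q N)) (allConfigs q N)

  isImage-intro : ∀ x {y} → f x ≡ y → T (isImage f y)
  isImage-intro x refl = ⇒does (any? _ (allConfigs q N)) (lose (allConfigs-complete x) refl)

  isImage⇒ : ∀ {y} → T (isImage f y) → ∃ λ x → f x ≡ y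
  isImage⇒ {y} h = satisfied (does⇒ (any? (λ x → ≡-dec _≟_ (f x) y) (allConfigs q N)) h)

count-by-fibers : {q N : ℕ} (p : Config q (suc N) → Bool) →
                  count p ≡ ∑ (allConfigs q N) (λ ys → card (λ a → p (a ∷ ys)))
count-by-fibers {q} {N} p = trans (count-cons p) (∑-swap (allFin q) (allConfigs q N) (λ a ys → ind (p (a ∷ ys))))

EdgeAlong : {q N : ℕ} → (Config q N → Bool) → Fin N → Set
EdgeAlong {q} {N} p v = ∃₂ λ (y : Config q N) (c : Fin q) → c ≢ lookup y v × T (p y) × T (p (y [ v ]≔ c))

dropHead : {q N : ℕ} → (Config q (suc N) → Bool) → Config q N → Bool
dropHead p ys = 0 <ᵇ card (λ a → p (a ∷ ys))

-- Dropping the first coordinate merges the two ends of the edge along it and keeps an edge in every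
-- other direction.
N<count-of-spanning : {q N : ℕ} (p : Config q N → Bool) → ∃ (T ∘ p) → (∀ v → EdgeAlong p v) → N < count p
N<count-of-spanning {q} {zero} p ([] , p[]) _ = ≤-trans (≤-reflexive (sym (T⇒ind≡1 p[]))) (m≤m+n _ 0)
N<count-of-spanning {q} {suc N} p (y ∷ ys , py) edges = begin-strict
  suc N                         ≤⟨ N<count-of-spanning (dropHead p) (ys , dropHead-intro py) dropped-edges ⟩
  count (dropHead p)            <⟨ dropHead<fibers ⟩
  ∑ (allConfigs q N) fiberCard  ≡⟨ count-by-fibers p ⟨
  count p                       ∎
  where
  open ≤-Reasoning
  fiberCard : Config q N → ℕ
  fiberCard zs = card (λ a → p (a ∷ zs))

  dropHead-intro : ∀ {a zs} → T (p (a ∷ zs)) → T (dropHead p zs)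
  dropHead-intro {zs = zs} pz = <⇒<ᵇ (1≤card (λ a → p (a ∷ zs)) pz)

  dropped-edges : ∀ v → EdgeAlong (dropHead p) v
  dropped-edges v with edges (suc v)
  ... | z ∷ zs , c , c≢ , p₁ , p₂ = zs , c , c≢ , dropHead-intro p₁ , dropHead-intro p₂

  ind-0<ᵇ : ∀ m → ind (0 <ᵇ m) ≤ m
  ind-0<ᵇ zero    = z≤n
  ind-0<ᵇ (suc m) = s≤s z≤n

  ind≤1 : ∀ b → ind b ≤ 1
  ind≤1 true  = ≤-refl
  ind≤1 false = z≤n

  dropHead<fibers : count (dropHead p) < ∑ (allConfigs q N) fiberCard
  dropHead<fibers with edges zero
  ... | z ∷ zs , c , c≢z , p₁ , p₂ =
    ∑-mono-< (allConfigs q N) (ind-0<ᵇ ∘ fiberCard) (allConfigs-complete zs)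
             (≤-trans (s≤s (ind≤1 _)) (2≤card _ (c≢z ∘ sym) p₁ p₂))

-- Interaction graphs

update-transport : {A : Set} {N : ℕ} (P : Vec A N → Set) (x x' : Vec A N) →
                   (∀ z u → lookup z u ≡ lookup x u → P z → P (z [ u ]≔ lookup x' u)) → P x → P x'
update-transport P []       []       step px = px
update-transport P (a ∷ as) (b ∷ bs) step px =
  update-transport (P ∘ (b ∷_)) as bs (λ z u → step (b ∷ z) (suc u)) (step (a ∷ as) zero refl px)

tabulate-update : {A B : Set} {N : ℕ} (g : Fin N → A → B) (xs : Vec A N) (v : Fin N) (e : A) →
                  tabulate (λ w → g w (lookup (xs [ v ]≔ e) w)) ≡ tabulate (λ w → g w (lookup xs w)) [ v ]≔ g v e
tabulate-update {B = B} {N} g xs v e = Pointwise-≡⇒≡ (ext pointwise)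
  where
  gxs : Vec B N
  gxs = tabulate (λ w → g w (lookup xs w))
  pointwise : ∀ w → lookup (tabulate (λ w → g w (lookup (xs [ v ]≔ e) w))) w
                  ≡ lookup (gxs [ v ]≔ g v e) w
  pointwise w with w ≟ v
  ... | yes refl = trans (lookup∘tabulate _ v)
                         (trans (cong (g v) (lookup∘update v xs e)) (sym (lookup∘update v gxs (g v e))))
  ... | no w≢v  = trans (lookup∘tabulate _ w)
                         (trans (cong (g w) (lookup∘update′ w≢v xs e))
                                (sym (trans (lookup∘update′ w≢v gxs (g v e)) (lookup∘tabulate _ w))))

module _ {q N : ℕ} {D : Digraph N} (f : Network q N) (f∈F : InF D q f) where

  nonArc⇒invariant : ∀ {u v} → D u v ≡ false → ∀ a c → lookup (f a) v ≡ lookup (f (a [ u ]≔ c)) v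
  nonArc⇒invariant {u} {v} noArc a c =
    decidable-stable (_ ≟ _) (λ differ → subst T noArc (Equivalence.to (f∈F u v) (a , c , differ)))

  agree-on-in-neighbours : ∀ v {x x'} → (∀ u → D u v ≡ true → lookup x u ≡ lookup x' u) →
                           lookup (f x) v ≡ lookup (f x') v
  agree-on-in-neighbours v {x} {x'} agree = update-transport (λ z → lookup (f x) v ≡ lookup (f z) v) x x' step refl
    where
    step : ∀ z u → lookup z u ≡ lookup x u → lookup (f x) v ≡ lookup (f z) v →
           lookup (f x) v ≡ lookup (f (z [ u ]≔ lookup x' u)) v
    step z u z≡x fx≡fz with D u v in arc
    ... | true  = subst (λ w → lookup (f x) v ≡ lookup (f w) v) (sym unchanged) fx≡fz
      where
      unchanged : z [ u ]≔ lookup x' u ≡ z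
      unchanged = trans (cong (z [ u ]≔_) (sym (trans z≡x (agree u arc)))) ([]≔-lookup z u)
    ... | false = trans fx≡fz (nonArc⇒invariant arc z (lookup x' u))

module F[Dthm] {n q : ℕ} (f : Network q (suc n)) (f∈F : InF (Dthm n) q f) where

  column : Fin q → Fin n → Fin q → Fin q
  column a v b = lookup (f (a ∷ replicate n b)) (suc v)

  columns : Fin q → Config q n → Config q n
  columns a xs = tabulate (λ v → column a v (lookup xs v))

  head-constant : ∀ x x' → lookup (f x) zero ≡ lookup (f x') zero
  head-constant x x' = agree-on-in-neighbours f f∈F zero (λ _ ())

  lookup-column : ∀ a xs v → lookup (f (a ∷ xs)) (suc v) ≡ column a v (lookup xs v)
  lookup-column a xs v = agree-on-in-neighbours f f∈F (suc v) agree
    where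
    agree : ∀ u → Dthm n u (suc v) ≡ true → lookup (a ∷ xs) u ≡ lookup (a ∷ replicate n (lookup xs v)) u
    agree zero    _   = refl
    agree (suc u) arc with eqFin⇒≡ {u = u} {v} (subst T (sym arc) tt)
    ... | refl = sym (lookup-replicate u (lookup xs u))

  normal-form : ∀ x a xs → f (a ∷ xs) ≡ lookup (f x) zero ∷ columns a xs
  normal-form x a xs = Pointwise-≡⇒≡ (ext λ where
    zero    → head-constant (a ∷ xs) x
    (suc v) → trans (lookup-column a xs v) (sym (lookup∘tabulate _ v)))

  columns-update : ∀ a xs v e → columns a (xs [ v ]≔ e) ≡ columns a xs [ v ]≔ column a v e
  columns-update a = tabulate-update (column a)

  column-nonconstant : ∀ v → ∃ λ a → ∃₂ λ b b' → column a v b ≢ column a v b'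
  column-nonconstant v with Equivalence.from (f∈F (suc v) (suc v)) (eqFin-refl v)
  ... | a ∷ xs , b' , differ = a , lookup xs v , b' , λ same → differ (begin
    lookup (f (a ∷ xs)) (suc v)              ≡⟨ lookup-column a xs v ⟩
    column a v (lookup xs v)                 ≡⟨ same ⟩
    column a v b'                            ≡⟨ cong (column a v) (lookup∘update v xs b') ⟨
    column a v (lookup (xs [ v ]≔ b') v)     ≡⟨ lookup-column a (xs [ v ]≔ b') v ⟨
    lookup (f (a ∷ (xs [ v ]≔ b'))) (suc v)  ∎)
    where open ≡-Reasoning

n<rank-Dthm : {n q : ℕ} (f : Network (suc q) (suc n)) → InF (Dthm n) (suc q) f → n < rank f
n<rank-Dthm {n} {q} f f∈F = begin-strict
  n                  <⟨ N<count-of-spanning inFiber (columns zero zeros , image zero zeros) edge ⟩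
  count inFiber      ≤⟨ fiber≤count (isImage f) c ⟩
  count (isImage f)  ≡⟨ rank≡count f ⟨
  rank f             ∎
  where
  open F[Dthm] f f∈F
  open ≤-Reasoning
  zeros : Config (suc q) n
  zeros = replicate n zero
  c : Fin (suc q)
  c = lookup (f (zero ∷ zeros)) zero
  inFiber : Config (suc q) n → Bool
  inFiber ys = isImage f (c ∷ ys)
  image : ∀ a xs → T (inFiber (columns a xs))
  image a xs = isImage-intro f (a ∷ xs) (normal-form (zero ∷ zeros) a xs)
  edge : ∀ v → EdgeAlong inFiber v
  edge v with column-nonconstant v
  ... | a , b , b' , b≢b' =
    columns a xs , column a v b' , differs , image a xs ,
    subst (T ∘ inFiber) (columns-update a xs v b') (image a (xs [ v ]≔ b'))
    where
    xs : Config (suc q) n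
    xs = replicate n b
    differs : column a v b' ≢ lookup (columns a xs) v
    differs same = b≢b' (sym (trans same (trans (lookup∘tabulate _ v) (cong (column a v) (lookup-replicate v b)))))

shape : {q n : ℕ} → Fin q → (Fin q → Fin n → Fin q → Fin q) → Network q (suc n)
shape c h (a ∷ xs) = c ∷ tabulate (λ v → h a v (lookup xs v))

module _ {q n : ℕ} (c : Fin q) (h : Fin q → Fin n → Fin q → Fin q) where

  shape-lookup : ∀ a xs v → lookup (shape c h (a ∷ xs)) (suc v) ≡ h a v (lookup xs v)
  shape-lookup a xs v = lookup∘tabulate _ v

  shape-replicate : ∀ a v b → lookup (shape c h (a ∷ replicate n b)) (suc v) ≡ h a v b
  shape-replicate a v b = trans (shape-lookup a (replicate n b) v) (cong (h a v) (lookup-replicate v b))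

  shape∈F : (∀ v → ∃ λ b → ∃₂ λ a a' → h a v b ≢ h a' v b) →
            (∀ v → ∃ λ a → ∃₂ λ b b' → h a v b ≢ h a v b') →
            InF (Dthm n) q (shape c h)
  shape∈F reads-head reads-own u v = mk⇔ (arc⇒ u v) (⇒arc u v)
    where
    arc⇒ : ∀ u v → IGArc (shape c h) u v → T (Dthm n u v)
    arc⇒ zero    zero    (_ ∷ _ , _ , differ) = differ refl
    arc⇒ (suc _) zero    (_ ∷ _ , _ , differ) = differ refl
    arc⇒ zero    (suc _) _                    = tt
    arc⇒ (suc i) (suc j) (a ∷ xs , e , differ) with i ≟ j
    ... | yes _  = tt
    ... | no i≢j = differ (begin
      lookup (shape c h (a ∷ xs)) (suc j)           ≡⟨ shape-lookup a xs j ⟩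
      h a j (lookup xs j)                           ≡⟨ cong (h a j) (lookup∘update′ (i≢j ∘ sym) xs e) ⟨
      h a j (lookup (xs [ i ]≔ e) j)                ≡⟨ shape-lookup a (xs [ i ]≔ e) j ⟨
      lookup (shape c h (a ∷ (xs [ i ]≔ e))) (suc j) ∎)
      where open ≡-Reasoning

    ⇒arc : ∀ u v → T (Dthm n u v) → IGArc (shape c h) u v
    ⇒arc zero (suc j) _ with reads-head j
    ... | b , a , a' , differ = a ∷ replicate n b , a' ,
      λ same → differ (trans (sym (shape-replicate a j b)) (trans same (shape-replicate a' j b)))
    ⇒arc (suc i) (suc j) arc with eqFin⇒≡ {u = i} {j} arc
    ... | refl with reads-own i
    ... | a , b , b' , differ = a ∷ replicate n b , b' ,
      λ same → differ (trans (sym (shape-replicate a i b))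
                      (trans same (trans (shape-lookup a (replicate n b [ i ]≔ b') i)
                                         (cong (h a i) (lookup∘update i (replicate n b) b')))))

-- The conjunctive network

allB-true : {A : Set} (p : A → Bool) (xs : List A) → (∀ u → p u ≡ true) → allB p xs ≡ true
allB-true p []       _      = refl
allB-true p (x ∷ xs) p≡true rewrite p≡true x = allB-true p xs p≡true

allB-false : {A : Set} (p : A → Bool) (xs : List A) {u : A} → u ∈ xs → p u ≡ false → allB p xs ≡ false
allB-false p (x ∷ xs) (here refl) pu≡false rewrite pu≡false = refl
allB-false p (x ∷ xs) (there u∈)  pu≡false = trans (cong (p x ∧_) (allB-false p xs u∈ pu≡false)) (∧-zeroʳ (p x))

count-cong-⇔ : {q N : ℕ} {p r : Config q N → Bool} → (∀ y → T (p y) → T (r y)) → (∀ y → T (r y) → T (p y)) →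
          count p ≡ count r
count-cong-⇔ p⇒r r⇒p = ≤-antisym (count-mono p⇒r) (count-mono r⇒p)

module _ (n : ℕ) where

  private
    f : Network 2 (suc n)
    f = conjNet (Dthm n)

  conj-head : ∀ x → lookup (f x) zero ≡ one
  conj-head x = cong fromBool (allB-true _ (allFin (suc n)) (λ _ → refl))

  conj-fixes : ∀ ys → f (one ∷ ys) ≡ one ∷ ys
  conj-fixes ys = Pointwise-≡⇒≡ (ext λ where
      zero    → conj-head (one ∷ ys)
      (suc j) → trans (lookup∘tabulate (λ v → fromBool (allB (conjunct v) (allFin (suc n)))) (suc j))
                      (coordinate j (lookup ys j) refl))
    where
    conjunct : Fin (suc n) → Fin (suc n) → Bool
    conjunct v u = not (Dthm n u v) ∨ isOne (lookup (one ∷ ys) u)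

    coordinate : ∀ j y → lookup ys j ≡ y → fromBool (allB (conjunct (suc j)) (allFin (suc n))) ≡ y
    coordinate j zero ys-j≡0 = cong fromBool (allB-false (conjunct (suc j)) (allFin (suc n)) (∈-allFin (suc j))
      (cong₂ (λ e y → not e ∨ isOne y) (Equivalence.to T-≡ (eqFin-refl j)) ys-j≡0))
    coordinate j (suc zero) ys-j≡1 = cong fromBool (allB-true (conjunct (suc j)) (allFin (suc n)) all-true)
      where
      all-true : ∀ u → conjunct (suc j) u ≡ true
      all-true zero    = refl
      all-true (suc i) with i ≟ j
      ... | yes refl = cong isOne ys-j≡1
      ... | no  _    = refl

crank-Dthm : (n : ℕ) → crank (Dthm n) ≡ 2 ^ n
crank-Dthm n = begin
  crank (Dthm n)                                  ≡⟨ rank≡count f ⟩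
  count (isImage f)                               ≡⟨ count-cong-⇔ image⇒head≡one head≡one⇒image ⟩
  count {2} {suc n} (λ y → eqFin (head y) one ∧ true) ≡⟨ count-head∧tail {2} {n} (λ a → eqFin a one) (λ _ → true) ⟩
  card (λ a → eqFin a one) * count {2} {n} (λ _ → true) ≡⟨ cong₂ _*_ (card-≡ one) (count-true n) ⟩
  1 * 2 ^ n                                       ≡⟨ *-identityˡ (2 ^ n) ⟩
  2 ^ n                                           ∎
  where
  open ≡-Reasoning
  f : Network 2 (suc n)
  f = conjNet (Dthm n)
  image⇒head≡one : ∀ y → T (isImage f y) → T (eqFin (head y) one ∧ true)
  image⇒head≡one y image with isImage⇒ f image
  ... | x , refl = subst (λ a → T (eqFin a one ∧ true)) (sym (conj-head n x)) tt
  head≡one⇒image : ∀ y → T (eqFin (head y) one ∧ true) → T (isImage f y)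
  head≡one⇒image (a ∷ ys) a≡one with eqFin⇒≡ {u = a} {one} (proj₁ (Equivalence.to T-∧ a≡one))
  ... | refl = isImage-intro f (one ∷ ys) (conj-fixes n ys)

-- Alphabet of size n

-- x₀ selects the one coordinate that reports whether its input is nonzero, so the image is 0 and the
-- n unit vectors.
module Selector (m : ℕ) where

  n : ℕ
  n = suc (suc m)

  bit : Fin n → Fin n
  bit zero    = zero
  bit (suc _) = suc zero

  h : Fin n → Fin n → Fin n → Fin n
  h a v b = if eqFin a v then bit b else zero

  h-selected : ∀ v b → h v v b ≡ bit b
  h-selected v b = cong (λ e → if e then bit b else zero) (Equivalence.to T-≡ (eqFin-refl v))

  h-unselected : ∀ {a v} b → a ≢ v → h a v b ≡ zero
  h-unselected b a≢v = cong (λ e → if e then bit b else zero) (eqFin-≢ a≢v)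

  f : Network n (suc n)
  f = shape zero h

  zeros : Config n n
  zeros = replicate n zero

  f∈F : InF (Dthm n) n f
  f∈F = shape∈F zero h reads-head reads-own
    where
    other : Fin n → Fin n
    other zero    = suc zero
    other (suc _) = zero

    other-≢ : ∀ v → other v ≢ v
    other-≢ zero    ()
    other-≢ (suc _) ()

    reads-head : ∀ v → ∃ λ b → ∃₂ λ a a' → h a v b ≢ h a' v b
    reads-head v = suc zero , v , other v , λ same →
      0≢suc (sym (trans (sym (h-selected v (suc zero))) (trans same (h-unselected (suc zero) (other-≢ v)))))

    reads-own : ∀ v → ∃ λ a → ∃₂ λ b b' → h a v b ≢ h a v b'
    reads-own v = v , zero , suc zero , λ same →
      0≢suc (trans (sym (h-selected v zero)) (trans same (h-selected v (suc zero))))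

  f-value : ∀ a xs → f (a ∷ xs) ≡ zero ∷ (zeros [ a ]≔ bit (lookup xs a))
  f-value a xs = cong (zero ∷_) (Pointwise-≡⇒≡ (ext pointwise))
    where
    pointwise : ∀ v → lookup (tabulate (λ v → h a v (lookup xs v))) v ≡ lookup (zeros [ a ]≔ bit (lookup xs a)) v
    pointwise v with v ≟ a
    ... | yes refl = trans (lookup∘tabulate (λ v → h a v (lookup xs v)) v) (trans (h-selected v (lookup xs v)) (sym (lookup∘update v zeros _)))
    ... | no  v≢a  = trans (lookup∘tabulate (λ v → h a v (lookup xs v)) v)
                           (trans (h-unselected (lookup xs v) (v≢a ∘ sym))
                                  (sym (trans (lookup∘update′ v≢a zeros _) (lookup-replicate v zero))))

  images : List (Config n (suc n))
  images = (zero ∷ zeros) ∷ map (λ a → zero ∷ (zeros [ a ]≔ suc zero)) (allFin n)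

  image∈images : ∀ x → f x ∈ images
  image∈images (a ∷ xs) rewrite f-value a xs with lookup xs a
  ... | zero  = here (cong (zero ∷_) (trans (cong (zeros [ a ]≔_) (sym (lookup-replicate a zero))) ([]≔-lookup zeros a)))
  ... | suc _ = there (∈-map⁺ (λ a → zero ∷ (zeros [ a ]≔ suc zero)) (∈-allFin a))

  rank-f : rank f ≡ suc n
  rank-f = ≤-antisym upper (n<rank-Dthm f f∈F)
    where
    upper : rank f ≤ suc n
    upper = begin
      rank f             ≡⟨ rank≡count f ⟩
      count (isImage f)  ≤⟨ count≤length (isImage f) images image⊆images ⟩
      length images      ≡⟨ cong suc (trans (length-map _ (allFin n)) (length-tabulate (λ v → v))) ⟩
      suc n              ∎
      where
      open ≤-Reasoning
      image⊆images : ∀ y → T (isImage f y) → y ∈ images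
      image⊆images y image with isImage⇒ f image
      ... | x , refl = image∈images x

-- Alphabet of size 2

count-complementary-boxes : {q n : ℕ} (t : Fin n → Bool) (S₀ S₁ : Fin n → Fin q → Bool) →
  (∀ v → card (S₀ v) ≡ 2 ^ ind (t v)) → (∀ v → card (S₁ v) ≡ 2 ^ ind (not (t v))) →
  (∀ v → card (λ y → S₀ v y ∧ S₁ v y) ≡ 1) →
  suc (count (λ ys → inBox S₀ ys ∨ inBox S₁ ys)) ≡ 2 ^ card t + 2 ^ card (not ∘ t)
count-complementary-boxes {q} {n} t S₀ S₁ card₀ card₁ card₀₁ = begin
  suc (count (λ ys → inBox S₀ ys ∨ inBox S₁ ys))
    ≡⟨ +-comm 1 _ ⟩
  count (λ ys → inBox S₀ ys ∨ inBox S₁ ys) + 1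
    ≡⟨ cong (count (λ ys → inBox S₀ ys ∨ inBox S₁ ys) +_) meet ⟨
  count (λ ys → inBox S₀ ys ∨ inBox S₁ ys) + count (λ ys → inBox S₀ ys ∧ inBox S₁ ys)
    ≡⟨ count-∨+∧ (inBox S₀) (inBox S₁) ⟩
  count (inBox S₀) + count (inBox S₁)
    ≡⟨ cong₂ _+_ (count-inBox S₀) (count-inBox S₁) ⟩
  ∏ (λ v → card (S₀ v)) + ∏ (λ v → card (S₁ v))
    ≡⟨ cong₂ _+_ (trans (∏-cong card₀) (∏-2^ind t)) (trans (∏-cong card₁) (∏-2^ind (not ∘ t))) ⟩
  2 ^ card t + 2 ^ card (not ∘ t) ∎
  where
  open ≡-Reasoning
  meet : count (λ ys → inBox S₀ ys ∧ inBox S₁ ys) ≡ 1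
  meet = begin
    count (λ ys → inBox S₀ ys ∧ inBox S₁ ys)    ≡⟨ count-cong (inBox-∧ S₀ S₁) ⟩
    count (inBox (λ v y → S₀ v y ∧ S₁ v y))     ≡⟨ count-inBox (λ v y → S₀ v y ∧ S₁ v y) ⟩
    ∏ (λ v → card (λ y → S₀ v y ∧ S₁ v y))      ≡⟨ trans (∏-cong card₀₁) (∏-1 n) ⟩
    1                                           ∎

module Split {n : ℕ} (t : Fin n → Bool) where

  active : Fin 2 → Fin n → Bool
  active zero    v = t v
  active (suc _) v = not (t v)

  h : Fin 2 → Fin n → Fin 2 → Fin 2
  h a v b = if active a v then b else zero

  h-active : ∀ a v → active a v ≡ true → ∀ b → h a v b ≡ b
  h-active a v act b = cong (λ e → if e then b else zero) act

  active-somewhere : ∀ v → ∃ λ a → active a v ≡ true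
  active-somewhere v with t v in tv
  ... | true  = zero , tv
  ... | false = one , cong not tv

  f : Network 2 (suc n)
  f = shape zero h

  f∈F : InF (Dthm n) 2 f
  f∈F = shape∈F zero h reads-head reads-own
    where
    reads-head : ∀ v → ∃ λ b → ∃₂ λ a a' → h a v b ≢ h a' v b
    reads-head v = one , zero , one , differ
      where
      differ : h zero v one ≢ h one v one
      differ with t v
      ... | true  = λ ()
      ... | false = λ ()

    reads-own : ∀ v → ∃ λ a → ∃₂ λ b b' → h a v b ≢ h a v b'
    reads-own v with active-somewhere v
    ... | a , act = a , zero , one , λ same → 0≢suc (trans (sym (h-active a v act zero)) (trans same (h-active a v act one)))

  box : Fin 2 → Fin n → Fin 2 → Bool
  box a v y = active a v ∨ eqFin zero y

  card-box : ∀ a v → card (box a v) ≡ 2 ^ ind (active a v)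
  card-box a v with active a v
  ... | true  = refl
  ... | false = refl

  card-box₀₁ : ∀ v → card (λ y → box zero v y ∧ box one v y) ≡ 1
  card-box₀₁ v with t v
  ... | true  = refl
  ... | false = refl

  image-in-box : ∀ a xs → T (inBox (box a) (tabulate (λ v → h a v (lookup xs v))))
  image-in-box a xs = ⇒inBox (box a) (tabulate (λ v → h a v (lookup xs v))) λ v →
    subst (T ∘ box a v) (sym (lookup∘tabulate (λ v → h a v (lookup xs v)) v)) (h-in-box v (lookup xs v))
    where
    h-in-box : ∀ v b → T (box a v (h a v b))
    h-in-box v b with active a v
    ... | true  = tt
    ... | false = tt

  inBoxes : Config 2 n → Bool
  inBoxes ys = inBox (box zero) ys ∨ inBox (box one) ys

  image⊆boxes : ∀ y → T (isImage f y) → T (eqFin (head y) zero ∧ inBoxes (tail y))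
  image⊆boxes y image with isImage⇒ f image
  ... | zero     ∷ xs , refl = Equivalence.from T-∨ (inj₁ (image-in-box zero xs))
  ... | suc zero ∷ xs , refl = Equivalence.from T-∨ (inj₂ (image-in-box one xs))

  rank-f : suc (rank f) ≤ 2 ^ card t + 2 ^ card (not ∘ t)
  rank-f = begin
    suc (rank f)                                              ≡⟨ cong suc (rank≡count f) ⟩
    suc (count (isImage f))                                   ≤⟨ s≤s (count-mono image⊆boxes) ⟩
    suc (count (λ y → eqFin (head y) zero ∧ inBoxes (tail y))) ≡⟨ cong suc (count-head∧tail {2} {n} (λ a → eqFin a zero) inBoxes) ⟩
    suc (card {2} (λ a → eqFin a zero) * count inBoxes)       ≡⟨ cong (λ k → suc (k * count inBoxes)) (card-≡ {2} zero) ⟩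
    suc (1 * count inBoxes)                                   ≡⟨ cong suc (*-identityˡ (count inBoxes)) ⟩
    suc (count inBoxes)                                       ≡⟨ count-complementary-boxes t (box zero) (box one)
                                                                   (card-box zero) (card-box one) card-box₀₁ ⟩
    2 ^ card t + 2 ^ card (not ∘ t)                           ∎
    where open ≤-Reasoning

pairImage : Fin 2 → Fin 2 → Fin 2 → Bool
pairImage α₀ α₁ y = eqFin α₀ y ∨ eqFin α₁ y

distinct : Fin 2 → Fin 2 → Bool
distinct α₀ α₁ = not (eqFin α₀ α₁)

-- Where α is onto, only the point β₀ of the image of β is kept, so that the two columns meet exactly once.
trimmedImage : Fin 2 → Fin 2 → Fin 2 → Fin 2 → Fin 2 → Bool
trimmedImage α₀ α₁ β₀ β₁ y = if distinct α₀ α₁ then eqFin β₀ y else pairImage β₀ β₁ y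

pairImage⇒preimage : (g : Fin 2 → Fin 2) {y : Fin 2} → T (pairImage (g zero) (g one) y) → ∃ λ b → g b ≡ y
pairImage⇒preimage g image with Equivalence.to T-∨ image
... | inj₁ g₀≡y = zero , eqFin⇒≡ g₀≡y
... | inj₂ g₁≡y = one  , eqFin⇒≡ g₁≡y

trimmed⇒pairImage : ∀ α₀ α₁ β₀ β₁ {y} → T (trimmedImage α₀ α₁ β₀ β₁ y) → T (pairImage β₀ β₁ y)
trimmed⇒pairImage α₀ α₁ β₀ β₁ trimmed with distinct α₀ α₁
... | true  = Equivalence.from T-∨ (inj₁ trimmed)
... | false = trimmed

nonconstant⇒distinct : (g : Fin 2 → Fin 2) {b b' : Fin 2} → g b ≢ g b' → T (distinct (g zero) (g one))
nonconstant⇒distinct g {b} {b'} differ with g zero ≟ g one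
... | no  _       = tt
... | yes g₀≡g₁ = differ (trans (constant b) (sym (constant b')))
  where
  constant : ∀ c → g c ≡ g zero
  constant zero       = refl
  constant (suc zero) = sym g₀≡g₁

column-pair-facts : ∀ α₀ α₁ β₀ β₁ → T (distinct α₀ α₁ ∨ distinct β₀ β₁) →
  card (pairImage α₀ α₁) ≡ 2 ^ ind (distinct α₀ α₁) ×
  card (trimmedImage α₀ α₁ β₀ β₁) ≡ 2 ^ ind (not (distinct α₀ α₁)) ×
  card (λ y → pairImage α₀ α₁ y ∧ trimmedImage α₀ α₁ β₀ β₁ y) ≡ 1
column-pair-facts zero       zero       zero       zero       ()
column-pair-facts zero       zero       zero       (suc zero) _ = refl , refl , refl
column-pair-facts zero       zero       (suc zero) zero       _ = refl , refl , refl
column-pair-facts zero       zero       (suc zero) (suc zero) ()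
column-pair-facts zero       (suc zero) zero       zero       _ = refl , refl , refl
column-pair-facts zero       (suc zero) zero       (suc zero) _ = refl , refl , refl
column-pair-facts zero       (suc zero) (suc zero) zero       _ = refl , refl , refl
column-pair-facts zero       (suc zero) (suc zero) (suc zero) _ = refl , refl , refl
column-pair-facts (suc zero) zero       zero       zero       _ = refl , refl , refl
column-pair-facts (suc zero) zero       zero       (suc zero) _ = refl , refl , refl
column-pair-facts (suc zero) zero       (suc zero) zero       _ = refl , refl , refl
column-pair-facts (suc zero) zero       (suc zero) (suc zero) _ = refl , refl , refl
column-pair-facts (suc zero) (suc zero) zero       zero       ()
column-pair-facts (suc zero) (suc zero) zero       (suc zero) _ = refl , refl , refl
column-pair-facts (suc zero) (suc zero) (suc zero) zero       _ = refl , refl , refl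
column-pair-facts (suc zero) (suc zero) (suc zero) (suc zero) ()

module Lower₂ {n : ℕ} (f : Network 2 (suc n)) (f∈F : InF (Dthm n) 2 f) where
  open F[Dthm] f f∈F

  α β : Fin n → Fin 2 → Fin 2
  α = column zero
  β = column one

  t : Fin n → Bool
  t v = distinct (α v zero) (α v one)

  S₀ S₁ : Fin n → Fin 2 → Bool
  S₀ v = pairImage (α v zero) (α v one)
  S₁ v = trimmedImage (α v zero) (α v one) (β v zero) (β v one)

  some-column-distinct : ∀ v → T (t v ∨ distinct (β v zero) (β v one))
  some-column-distinct v with column-nonconstant v
  ... | zero     , _ , _ , differ = Equivalence.from T-∨ (inj₁ (nonconstant⇒distinct (α v) differ))
  ... | suc zero , _ , _ , differ = Equivalence.from T-∨ (inj₂ (nonconstant⇒distinct (β v) differ))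

  facts : ∀ v → card (S₀ v) ≡ 2 ^ ind (t v) × card (S₁ v) ≡ 2 ^ ind (not (t v)) ×
                card (λ y → S₀ v y ∧ S₁ v y) ≡ 1
  facts v = column-pair-facts (α v zero) (α v one) (β v zero) (β v one) (some-column-distinct v)

  x₀ : Config 2 (suc n)
  x₀ = replicate (suc n) zero

  c : Fin 2
  c = lookup (f x₀) zero

  box⊆fiber : ∀ a ys → (∀ v → T (pairImage (column a v zero) (column a v one) (lookup ys v))) → T (isImage f (c ∷ ys))
  box⊆fiber a ys inImage = isImage-intro f (a ∷ xs) (trans (normal-form x₀ a xs) (cong (c ∷_) columns≡ys))
    where
    xs : Config 2 n
    xs = tabulate (λ v → proj₁ (pairImage⇒preimage (column a v) (inImage v)))
    columns≡ys : columns a xs ≡ ys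
    columns≡ys = Pointwise-≡⇒≡ (ext λ v → trans (lookup∘tabulate _ v) (trans (cong (column a v) (lookup∘tabulate _ v))
                                                  (proj₂ (pairImage⇒preimage (column a v) (inImage v)))))

  lower : 2 ^ card t + 2 ^ card (not ∘ t) ≤ suc (rank f)
  lower = begin
    2 ^ card t + 2 ^ card (not ∘ t)                 ≡⟨ count-complementary-boxes t S₀ S₁ (proj₁ ∘ facts)
                                                          (proj₁ ∘ proj₂ ∘ facts) (proj₂ ∘ proj₂ ∘ facts) ⟨
    suc (count (λ ys → inBox S₀ ys ∨ inBox S₁ ys))  ≤⟨ s≤s (count-mono boxes⊆fiber) ⟩
    suc (count (λ ys → isImage f (c ∷ ys)))         ≤⟨ s≤s (fiber≤count (isImage f) c) ⟩
    suc (count (isImage f))                         ≡⟨ cong suc (rank≡count f) ⟨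
    suc (rank f)                                    ∎
    where
    open ≤-Reasoning
    boxes⊆fiber : ∀ ys → T (inBox S₀ ys ∨ inBox S₁ ys) → T (isImage f (c ∷ ys))
    boxes⊆fiber ys inBoxes with Equivalence.to T-∨ inBoxes
    ... | inj₁ in₀ = box⊆fiber zero ys (inBox⇒ S₀ ys in₀)
    ... | inj₂ in₁ = box⊆fiber one ys (λ v → trimmed⇒pairImage (α v zero) (α v one) (β v zero) (β v one) (inBox⇒ S₁ ys in₁ v))

⌈n/2⌉+⌊n/2⌋≡n : ∀ n → ⌈ n /2⌉ + ⌊ n /2⌋ ≡ n
⌈n/2⌉+⌊n/2⌋≡n n = trans (+-comm ⌈ n /2⌉ ⌊ n /2⌋) (⌊n/2⌋+⌈n/2⌉≡n n)

2^c+2^d≤2^a+2^b : ∀ {a b c d} → d ≤ c → c ≤ a → a + b ≡ c + d → 2 ^ c + 2 ^ d ≤ 2 ^ a + 2 ^ b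
2^c+2^d≤2^a+2^b {a} {b} {c} {d} d≤c c≤a a+b≡c+d with m≤n⇒m<n∨m≡n c≤a
... | inj₂ refl = ≤-reflexive (cong (λ k → 2 ^ c + 2 ^ k) (sym (+-cancelˡ-≡ c b d a+b≡c+d)))
... | inj₁ c<a  = begin
  2 ^ c + 2 ^ d        ≤⟨ +-monoʳ-≤ (2 ^ c) (^-monoʳ-≤ 2 d≤c) ⟩
  2 ^ c + 2 ^ c        ≡⟨ cong (2 ^ c +_) (+-identityʳ (2 ^ c)) ⟨
  2 ^ suc c            ≤⟨ ^-monoʳ-≤ 2 c<a ⟩
  2 ^ a                ≤⟨ m≤m+n (2 ^ a) (2 ^ b) ⟩
  2 ^ a + 2 ^ b        ∎
  where open ≤-Reasoning

2^⌈n/2⌉+2^⌊n/2⌋≤2^a+2^b : ∀ {n} a b → a + b ≡ n → 2 ^ ⌈ n /2⌉ + 2 ^ ⌊ n /2⌋ ≤ 2 ^ a + 2 ^ b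
2^⌈n/2⌉+2^⌊n/2⌋≤2^a+2^b {n} a b a+b≡n with ⌈ n /2⌉ ≤? a | ⌈ n /2⌉ ≤? b
... | yes c≤a | _       = 2^c+2^d≤2^a+2^b (⌊n/2⌋≤⌈n/2⌉ n) c≤a (trans a+b≡n (sym (⌈n/2⌉+⌊n/2⌋≡n n)))
... | no _    | yes c≤b = subst (2 ^ ⌈ n /2⌉ + 2 ^ ⌊ n /2⌋ ≤_) (+-comm (2 ^ b) (2 ^ a))
  (2^c+2^d≤2^a+2^b (⌊n/2⌋≤⌈n/2⌉ n) c≤b (trans (+-comm b a) (trans a+b≡n (sym (⌈n/2⌉+⌊n/2⌋≡n n)))))
... | no c≰a  | no c≰b  = ⊥-elim (1+n≰n (≤-pred (begin
  suc (suc n)              ≡⟨ cong (λ k → suc (suc k)) a+b≡n ⟨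
  suc (suc (a + b))        ≡⟨ cong suc (+-suc a b) ⟨
  suc a + suc b            ≤⟨ +-mono-≤ (≰⇒> c≰a) (≰⇒> c≰b) ⟩
  ⌈ n /2⌉ + ⌈ n /2⌉        ≤⟨ +-monoʳ-≤ ⌈ n /2⌉ (⌊n/2⌋-mono (n≤1+n (suc n))) ⟩
  ⌈ n /2⌉ + suc ⌊ n /2⌋    ≡⟨ +-suc ⌈ n /2⌉ ⌊ n /2⌋ ⟩
  suc (⌈ n /2⌉ + ⌊ n /2⌋)  ≡⟨ cong suc (⌈n/2⌉+⌊n/2⌋≡n n) ⟩
  suc n                    ∎)))
  where open ≤-Reasoning

card-<ᵇ : {n : ℕ} (m : ℕ) → m ≤ n → card {n} (λ j → toℕ j <ᵇ m) ≡ m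
card-<ᵇ {n}     zero    _         = ∑-const-0 (allFin n)
card-<ᵇ {suc n} (suc m) (s≤s m≤n) = trans (card-suc {n} (λ j → toℕ j <ᵇ suc m)) (cong suc (card-<ᵇ m m≤n))

minrank₂-Dthm : (n : ℕ) → MinrankIs (Dthm n) 2 (2 ^ ⌈ n /2⌉ + 2 ^ ⌊ n /2⌋ ∸ 1)
minrank₂-Dthm n = (Split.f t , Split.f∈F t , ≤-antisym upper (lower (Split.f t) (Split.f∈F t))) , lower
  where
  t : Fin n → Bool
  t j = toℕ j <ᵇ ⌈ n /2⌉

  card-t : card t ≡ ⌈ n /2⌉
  card-t = card-<ᵇ ⌈ n /2⌉ (⌈n/2⌉≤n n)

  card-not-t : card (not ∘ t) ≡ ⌊ n /2⌋
  card-not-t = +-cancelˡ-≡ ⌈ n /2⌉ _ _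
    (trans (cong (_+ card (not ∘ t)) (sym card-t)) (trans (card+card-not t) (sym (⌈n/2⌉+⌊n/2⌋≡n n))))

  upper : rank (Split.f t) ≤ 2 ^ ⌈ n /2⌉ + 2 ^ ⌊ n /2⌋ ∸ 1
  upper = ∸-monoˡ-≤ 1 (subst (λ k → suc (rank (Split.f t)) ≤ k) (cong₂ (λ a b → 2 ^ a + 2 ^ b) card-t card-not-t) (Split.rank-f t))

  lower : ∀ f → InF (Dthm n) 2 f → 2 ^ ⌈ n /2⌉ + 2 ^ ⌊ n /2⌋ ∸ 1 ≤ rank f
  lower f f∈F = ∸-monoˡ-≤ 1 (≤-trans (2^⌈n/2⌉+2^⌊n/2⌋≤2^a+2^b (card t') (card (not ∘ t')) (card+card-not t')) lower₂)
    where open Lower₂ f f∈F using () renaming (t to t'; lower to lower₂)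

minrankₙ-Dthm : {n : ℕ} → 2 ≤ n → MinrankIs (Dthm n) n (suc n)
minrankₙ-Dthm {suc (suc m)} (s≤s (s≤s _)) = (f , f∈F , rank-f) , n<rank-Dthm
  where open Selector m

minrank-Dthm : {n : ℕ} → 2 ≤ n → MinrankAllIs (Dthm n) (suc n)
minrank-Dthm {n} 2≤n = (n , 2≤n , proj₁ (minrankₙ-Dthm 2≤n)) , λ where
  (suc (suc q)) (s≤s (s≤s _)) f f∈F → n<rank-Dthm f f∈F

theorem3p10 : (n : ℕ) → 3 ≤ n → n % 2 ≡ 1 →
    (crank (Dthm n) ≡ 2 ^ n) ×
    MinrankIs (Dthm n) 2 (2 ^ ⌈ n /2⌉ + 2 ^ ⌊ n /2⌋ ∸ 1) ×
    MinrankIs (Dthm n) n (suc n) ×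
    MinrankAllIs (Dthm n) (suc n)
theorem3p10 n 3≤n _ = crank-Dthm n , minrank₂-Dthm n , minrankₙ-Dthm 2≤n , minrank-Dthm 2≤n
  where
  2≤n : 2 ≤ n
  2≤n = ≤-trans (n≤1+n 2) 3≤n
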